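{- Let $k\in\mathbb{N}^+$ and let $A$ be a Discoverer algorithm for the source detection game with consistent source behavior (with either known or unknown static graph) that watches $k$ nodes per round. Then there is a Discoverer algorithm $A^1$ that watches one node per round such that, whenever $A$ tolerates at most $x$ successful infections in some instance of the game, $A^1$ tolerates at most $kx$ infections in the same instance.
   Context: A simple temporal graph $(V,E,\lambda)$ with lifetime $T_{\max}$ has labeling $\lambda\colon E\to\{1,\dots,T_{\max}\}$; edge $e$ exists only at time $\lambda(e)$. SIR model with parameter $\delta$: nodes start susceptible; a seed $(v,t)$ infects $v$ at time $t$; a susceptible $u$ becomes infected at time $t$ iff a neighbor $v$ is infectious at time $t$ and $\lambda(uv)=t$; a node infected at time $t$ is infectious at $t+1,\dots,t+\delta$ and resistant afterwards. Source detection game (consistent source behavior, $k$ watched nodes): the Adversary picks $V$, $T_{\max}$, $\delta$, static edges $E$, labeling $\lambda$, source $s$ and start time $t_0$; in every round the process is run with the same single seed $(s,t_0)$. Before each round the Discoverer chooses at most $k$ nodes to watch and learns for each whether, when and by which neighbor (or by seeding) it was infected; it initially knows $V,T_{\max},\delta$ and, in the known-graph variant, also $E$. When it ends the game it names a node and wins iff no configuration with a different source is consistent with its observations. The number of infections tolerated is the total number of nodes infected, summed over all rounds played. -}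

module Defs where

open import Data.Nat using (ℕ; zero; suc; _+_; _*_; _≤_; _<ᵇ_; _≤ᵇ_; _≡ᵇ_)
open import Data.Bool using (Bool; true; false; _∧_; _∨_; if_then_else_)
open import Data.Fin using (Fin)
open import Data.Fin.Properties using () renaming (_≟_ to _≟ᶠ_)
open import Data.Fin.Subset using (Subset)
open import Data.Maybe using (Maybe; just; nothing; is-just)
open import Data.List using (List; []; _∷_; map; length; allFin)
open import Data.Bool.ListAction using (any)
open import Data.Nat.ListAction using (sum)
open import Data.List.Relation.Unary.All using (All)
open import Data.Vec using (tabulate)
open import Data.Product using (Σ; _×_; _,_; ∃-syntax)
open import Data.Unit using (⊤)
open import Relation.Nullary.Decidable using (⌊_⌋)
open import Relation.Binary.PropositionalEquality using (_≡_)

record Params : Set where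
  field
    n    : ℕ
    Tmax : ℕ
    δ    : ℕ
    δpos : 1 ≤ δ
open Params public

-- A configuration chosen by the Adversary (given V, T_max, δ):
-- a simple static graph E (symmetric, irreflexive adjacency), a labeling
-- λ : E → {1..T_max} (given as a symmetric function, only its values on
-- edges matter), the source s and the start time t0 ∈ {1..T_max}.

record Config (P : Params) : Set where
  field
    adj      : Fin (n P) → Fin (n P) → Bool
    adjSym   : ∀ u v → adj u v ≡ adj v u
    adjIrr   : ∀ u → adj u u ≡ false
    lab      : Fin (n P) → Fin (n P) → ℕ
    labSym   : ∀ u v → lab u v ≡ lab v u
    labRange : ∀ u v → adj u v ≡ true → 1 ≤ lab u v × lab u v ≤ Tmax P
    src      : Fin (n P)
    t0       : ℕ
    t0Range  : 1 ≤ t0 × t0 ≤ Tmax P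
open Config public

-- The (deterministic) SIR process with single seed (src, t0).

module _ {P : Params} (C : Config P) where

  infectiousAt : Maybe ℕ → ℕ → Bool
  infectiousAt nothing   t = false
  infectiousAt (just ti) t = (ti <ᵇ t) ∧ (t ≤ᵇ ti + δ P)

  transmits : (Fin (n P) → Maybe ℕ) → Fin (n P) → Fin (n P) → ℕ → Bool
  transmits st u v t = adj C u v ∧ (lab C u v ≡ᵇ t) ∧ infectiousAt (st v) t

  stateAt : ℕ → Fin (n P) → Maybe ℕ
  stateAt zero    u = nothing
  stateAt (suc t) u with stateAt t u
  ... | just ti = just ti
  ... | nothing =
        if (⌊ src C ≟ᶠ u ⌋ ∧ (t0 C ≡ᵇ suc t))
           ∨ any (λ v → transmits (stateAt t) u v (suc t)) (allFin (n P))
        then just (suc t) else nothing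

  infTime : Fin (n P) → Maybe ℕ
  infTime = stateAt (Tmax P)

  infectors : Fin (n P) → ℕ → Subset (n P)
  infectors u t = tabulate (λ v → transmits infTime u v t)

data Obs (m : ℕ) : Set where
  notInfected : Obs m
  seeded      : ℕ → Obs m
  infectedBy  : ℕ → Subset m → Obs m

module _ {P : Params} (C : Config P) where

  observe : Fin (n P) → Obs (n P)
  observe u with ⌊ src C ≟ᶠ u ⌋ | infTime C u
  ... | true  | _       = seeded (t0 C)
  ... | false | nothing = notInfected
  ... | false | just t  = infectedBy t (infectors C u t)

  infectedCount : ℕ
  infectedCount = sum (map (λ u → if is-just (infTime C u) then 1 else 0) (allFin (n P)))

  roundObs : List (Fin (n P)) → List (Fin (n P) × Obs (n P))
  roundObs S = map (λ u → u , observe u) S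

-- History: one entry per round played (most recent first), listing the
-- watched nodes together with what was observed.
History : Params → Set
History P = List (List (Fin (n P) × Obs (n P)))

Consistent : {P : Params} → Config P → History P → Set
Consistent C h = All (All (λ { (u , o) → observe C u ≡ o })) h

data Variant : Set where
  knownGraph unknownGraph : Variant

Info : Variant → Params → Set
Info knownGraph   P = Fin (n P) → Fin (n P) → Bool
Info unknownGraph P = ⊤

info : (var : Variant) → {P : Params} → Config P → Info var P
info knownGraph   C = adj C
info unknownGraph C = _

SameInfo : (var : Variant) → {P : Params} → Config P → Config P → Set
SameInfo knownGraph   C C' = ∀ u v → adj C u v ≡ adj C' u v
SameInfo unknownGraph C C' = ⊤

data Decision (k m : ℕ) : Set where
  stop  : Fin m → Decision k m
  watch : (S : List (Fin m)) → length S ≤ k → Decision k m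

Strategy : Variant → ℕ → Set
Strategy var k = (P : Params) → Info var P → History P → Decision k (n P)

-- Runs A C h r v h' : from history h, the game lasts r more rounds and the
-- Discoverer then stops naming v, with final history h'.
data Runs {k : ℕ} {P : Params} (A : History P → Decision k (n P)) (C : Config P)
     : History P → ℕ → Fin (n P) → History P → Set where
  done : ∀ {h v} → A h ≡ stop v → Runs A C h 0 v h
  step : ∀ {h S p r v h'} → A h ≡ watch S p →
         Runs A C (roundObs C S ∷ h) r v h' → Runs A C h (suc r) v h'

Wins : (var : Variant) → {P : Params} → Config P → History P → Fin (n P) → Set
Wins var {P} C h v = (C' : Config P) → SameInfo var C C' → Consistent C' h → src C' ≡ v

-- A tolerates at most x infections on instance C: it ends the game, wins,
-- and the total number of infected nodes over all rounds played is ≤ x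
-- (each round infects the same set, so this is rounds * infectedCount).
Tolerates : (var : Variant) {k : ℕ} → Strategy var k → {P : Params} → Config P → ℕ → Set
Tolerates var A {P} C x =
  ∃[ r ] ∃[ v ] ∃[ h ] (Runs (A P (info var C)) C [] r v h × Wins var C h v × r * infectedCount C ≤ x)

-- A k-watching Discoverer is simulated by a 1-watching one: each round of A
-- watching S is replaced by |S| rounds watching one node of S each (one empty
-- round if S is empty). Since the source behaves consistently, every node
-- reports the same observation in every round, so after these rounds the
-- simulator can assemble exactly the observation A would have received and
-- continue with A's next decision. Every configuration consistent with the
-- simulator's history is consistent with A's, so the final guess still wins,
-- and each round of A costs at most k rounds of the simulator.
module Submission where

open import Defs
open import Data.Nat using (ℕ; suc; _+_; _*_; _≤_; z≤n; s≤s)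
open import Data.Nat.Properties using (≤-trans; *-suc; +-mono-≤; *-monoˡ-≤; *-monoʳ-≤; *-assoc)
open import Data.Product using (Σ; ∃-syntax; _×_; _,_)
open import Data.Maybe using (Maybe; just; nothing)
open import Data.Fin using (Fin)
open import Data.List using (List; []; _∷_; _++_; map; concat; length; concatMap; fromMaybe)
open import Data.List.NonEmpty as List⁺ using (List⁺; _∷_)
open import Data.List.Properties using (length-map; map-++; map-∘; concat-map-[_]; ++-assoc; ++-identityʳ)
open import Data.List.Relation.Unary.All using ([]; _∷_)
open import Data.List.Relation.Unary.All.Properties using (++⁺)
open import Relation.Binary.PropositionalEquality using (_≡_; refl; sym; trans; cong; subst)
open Relation.Binary.PropositionalEquality.≡-Reasoning

private variable
  m : ℕ

length-fromMaybe : (q : Maybe (Fin m)) → length (fromMaybe q) ≤ 1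
length-fromMaybe nothing  = z≤n
length-fromMaybe (just _) = s≤s z≤n

-- An empty round of A stays one (empty) round, so every round of A costs at
-- least one round of the simulator.
singletons : List (Fin m) → List⁺ (Maybe (Fin m))
singletons []       = nothing ∷ []
singletons (u ∷ us) = just u ∷ map just us

concatMap-fromMaybe-singletons : (S : List (Fin m)) →
  concatMap fromMaybe (List⁺.toList (singletons S)) ≡ S
concatMap-fromMaybe-singletons []       = refl
concatMap-fromMaybe-singletons (u ∷ us) =
  cong (u ∷_) (trans (cong concat (sym (map-∘ us))) concat-map-[ us ])

length-singletons : ∀ {k} → 1 ≤ k → (S : List (Fin m)) → length S ≤ k →
  List⁺.length (singletons S) ≤ k
length-singletons 1≤k []       _ = 1≤k
length-singletons 1≤k (u ∷ us) |S|≤k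
  rewrite length-map (just {A = Fin _}) us = |S|≤k

Round : Params → Set
Round P = List (Fin (n P) × Obs (n P))

module _ {k : ℕ} {P : Params} where

  data Plays (D : History P → Decision k (n P)) (C : Config P) :
       History P → ℕ → History P → Set where
    []  : ∀ {h} → Plays D C h 0 h
    _∷_ : ∀ {h S p m h'} → D h ≡ watch S p →
          Plays D C (roundObs C S ∷ h) m h' → Plays D C h (suc m) h'

  Plays-Runs : ∀ {D C h m h' r v hf} → Plays D C h m h' → Runs D C h' r v hf →
    Runs D C h (m + r) v hf
  Plays-Runs []        runs = runs
  Plays-Runs (e ∷ ps) runs = step e (Plays-Runs ps runs)

Justifies : (P : Params) → History P → History P → Set
Justifies P h' h = (C' : Config P) → Consistent C' h' → Consistent C' h

Justifies-++ : {P : Params} {h hA : History P} {xs ys : Round P} →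
  Justifies P h (xs ∷ hA) → Justifies P (ys ∷ h) ((xs ++ ys) ∷ hA)
Justifies-++ j C' (cys ∷ ch) with j C' ch
... | cxs ∷ chA = ++⁺ cxs cys ∷ chA

module Simulation {k : ℕ} {P : Params} (A : History P → Decision k (n P)) where

  -- A's history, the observations gathered in A's current round, and the
  -- single-node rounds still to be played for it.
  State : Set
  State = History P × Round P × List (Maybe (Fin (n P)))

  pending : Decision k (n P) → List (Maybe (Fin (n P)))
  pending (stop _)    = []
  pending (watch S _) = List⁺.toList (singletons S)

  start : History P → State
  start hA = hA , [] , pending (A hA)

  update : State → Round P → State
  update (hA , acc , [])         x = hA , acc , []
  update (hA , acc , _ ∷ [])     x = start ((acc ++ x) ∷ hA)
  update (hA , acc , _ ∷ q ∷ qs) x = hA , acc ++ x , q ∷ qs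

  state : History P → State
  state []      = start []
  state (x ∷ h) = update (state h) x

  -- The clause for an exhausted round is never reached: A has stopped then.
  next : Decision k (n P) → List (Maybe (Fin (n P))) → Decision 1 (n P)
  next (stop v)    _       = stop v
  next (watch _ _) []      = watch [] z≤n
  next (watch _ _) (q ∷ _) = watch (fromMaybe q) (length-fromMaybe q)

  A¹ : History P → Decision 1 (n P)
  A¹ h with state h
  ... | hA , _ , qs = next (A hA) qs

  A¹-watches : ∀ {h hA acc q qs S p} → state h ≡ (hA , acc , q ∷ qs) →
    A hA ≡ watch S p → A¹ h ≡ watch (fromMaybe q) (length-fromMaybe q)
  A¹-watches {h} st e with state h
  A¹-watches refl e | _ rewrite e = refl

  A¹-stops : ∀ {h hA v} → state h ≡ start hA → A hA ≡ stop v → A¹ h ≡ stop v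
  A¹-stops {h} st e with state h
  A¹-stops refl e | _ rewrite e = refl

  module _ (C : Config P) where

    playRound : ∀ {hA S p} → A hA ≡ watch S p →
      ∀ q qs {acc h} → state h ≡ (hA , acc , q ∷ qs) →
      acc ++ roundObs C (concatMap fromMaybe (q ∷ qs)) ≡ roundObs C S →
      Justifies P h (acc ∷ hA) →
      ∃[ h' ] Plays A¹ C h (suc (length qs)) h' ×
              state h' ≡ start (roundObs C S ∷ hA) × Justifies P h' (roundObs C S ∷ hA)
    playRound {hA} {S} e q [] {acc} {h} st obs j =
      x ∷ h , A¹-watches {h} st e ∷ [] ,
      trans (cong (λ s → update s x) st) (cong (λ r → start (r ∷ hA)) acc++x) ,
      subst (λ r → Justifies P (x ∷ h) (r ∷ hA)) acc++x (Justifies-++ j)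
      where
      x = roundObs C (fromMaybe q)
      acc++x : acc ++ x ≡ roundObs C S
      acc++x = trans (cong (λ ys → acc ++ roundObs C ys) (sym (++-identityʳ _))) obs
    playRound {hA} {S} e q (q' ∷ qs) {acc} {h} st obs j
      with playRound e q' qs {acc ++ x} {x ∷ h} (cong (λ s → update s x) st) obs′ (Justifies-++ j)
      where
      x = roundObs C (fromMaybe q)
      obs′ : (acc ++ x) ++ roundObs C (concatMap fromMaybe (q' ∷ qs)) ≡ roundObs C S
      obs′ = begin
        (acc ++ x) ++ roundObs C (concatMap fromMaybe (q' ∷ qs))
          ≡⟨ ++-assoc acc x _ ⟩
        acc ++ x ++ roundObs C (concatMap fromMaybe (q' ∷ qs))
          ≡⟨ cong (acc ++_) (sym (map-++ _ (fromMaybe q) _)) ⟩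
        acc ++ roundObs C (concatMap fromMaybe (q ∷ q' ∷ qs))
          ≡⟨ obs ⟩
        roundObs C S ∎
    ... | h' , plays , st' , j = h' , A¹-watches {h} st e ∷ plays , st' , j

    simulate : 1 ≤ k → ∀ {hA r v hf} → Runs A C hA r v hf →
      ∀ {h} → state h ≡ start hA → Justifies P h hA →
      ∃[ r¹ ] ∃[ h' ] Runs A¹ C h r¹ v h' × r¹ ≤ k * r × Justifies P h' hf
    simulate 1≤k (done e) {h} st j = 0 , h , done (A¹-stops {h} st e) , z≤n , j
    simulate 1≤k {hA} {suc r} (step {S = S} {p = p} e runs) {h} st j
      with playRound e (List⁺.head pieces) (List⁺.tail pieces)
             (trans st (cong (λ d → hA , [] , pending d) e))
             (cong (roundObs C) (concatMap-fromMaybe-singletons S))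
             (λ C' c → [] ∷ j C' c)
      where pieces = singletons S
    ... | h' , plays , st' , j'
      with simulate 1≤k runs st' j'
    ... | r¹ , h'' , runs¹ , r¹≤k*r , j'' =
      _ , h'' , Plays-Runs plays runs¹ , rounds≤ , j''
      where
      rounds≤ : List⁺.length (singletons S) + r¹ ≤ k * suc r
      rounds≤ = subst (List⁺.length (singletons S) + r¹ ≤_) (sym (*-suc k r))
                  (+-mono-≤ (length-singletons 1≤k S p) r¹≤k*r)

mainTheorem16 : (var : Variant) (k : ℕ) → 1 ≤ k → (A : Strategy var k) →
    Σ (Strategy var 1) (λ A1 → (P : Params) (C : Config P) (x : ℕ) →
      Tolerates var A C x → Tolerates var A1 C (k * x))
mainTheorem16 var k 1≤k A = A¹ , tolerates
  where
  A¹ : Strategy var 1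
  A¹ P I = Simulation.A¹ (A P I)

  tolerates : (P : Params) (C : Config P) (x : ℕ) →
    Tolerates var A C x → Tolerates var A¹ C (k * x)
  tolerates P C x (r , v , h , runs , wins , cost≤x)
    with Simulation.simulate (A P (info var C)) C 1≤k runs refl (λ _ c → c)
  ... | r¹ , h¹ , runs¹ , r¹≤k*r , justified =
    r¹ , v , h¹ , runs¹ , (λ C' same c → wins C' same (justified C' c)) , cost¹≤k*x
    where
    cost¹≤k*x : r¹ * infectedCount C ≤ k * x
    cost¹≤k*x = ≤-trans (*-monoˡ-≤ (infectedCount C) r¹≤k*r)
                  (subst (_≤ k * x) (sym (*-assoc k r (infectedCount C))) (*-monoʳ-≤ k cost≤x))
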